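{- Let $P$ be a non-empty set and $\mathcal{L}$ a set of formulae with semantic function $[\![\cdot]\!]:\mathcal{L}\to\mathcal{P}(P)$ such that $\mathcal{L}(p)\neq\emptyset$ for every $p\in P$. Suppose $\mathcal{L}$ features the Boolean connective $\wedge$ and is finitely characterized by $\mathcal{B}$ for some monotonic $\mathcal{B}$. Then each formula $\phi\in\mathcal{L}$ is represented by some set $\mathit{rep}(\phi)\subseteq P$, and this set is unique up to logical equivalence of processes.
   Context: For $p\in P$, $\mathcal{L}(p)=\{\phi\in\mathcal{L}\mid p\in[\![\phi]\!]\}$ and $\uparrow p=\{p'\in P\mid\mathcal{L}(p)\subseteq\mathcal{L}(p')\}$. Processes $p,q$ are logically equivalent iff $\mathcal{L}(p)=\mathcal{L}(q)$, and incomparable iff neither $\mathcal{L}(p)\subseteq\mathcal{L}(q)$ nor $\mathcal{L}(q)\subseteq\mathcal{L}(p)$. A set $S\subseteq P$ represents $\phi$ iff its elements are pairwise incomparable and $[\![\phi]\!]=\bigcup_{p\in S}\uparrow p$. "$\mathcal{L}$ features $\wedge$" means that for all $\phi,\psi\in\mathcal{L}$ there is $\phi\wedge\psi\in\mathcal{L}$ with $[\![\phi\wedge\psi]\!]=[\![\phi]\!]\cap[\![\psi]\!]$. $\mathcal{L}$ is characterized by $\mathcal{B}:P\to\mathcal{P}(\mathcal{L})$ iff for each $p\in P$: $\emptyset\subsetneq\mathcal{B}(p)\subseteq\mathcal{L}(p)$ and for each $\phi\in\mathcal{L}(p)$, $\bigcap_{\psi\in\mathcal{B}(p)}[\![\psi]\!]\subseteq[\![\phi]\!]$;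 finitely characterized if moreover each $\mathcal{B}(p)$ is finite. $\mathcal{B}$ is monotonic iff $\mathcal{L}(p)\subseteq\mathcal{L}(q)$ implies $\mathcal{B}(p)\subseteq\mathcal{B}(q)$. -}

module Defs where

open import Level using (0ℓ)
open import Data.Product using (Σ; ∃; _×_; _,_)
open import Data.List using (List; [])
open import Data.List.Relation.Unary.All using (All)
open import Data.List.Membership.Propositional using (_∈_)
open import Relation.Nullary using (¬_)
open import Relation.Binary.PropositionalEquality using (_≡_; _≢_)
open import Function.Bundles using (_⇔_)

module _ {P Form : Set} (sem : Form → P → Set) where

  _⊑_ : P → P → Set
  p ⊑ q = ∀ φ → sem φ p → sem φ q

  up : P → P → Set
  up p p' = p ⊑ p'

  LogEquiv : P → P → Set
  LogEquiv p q = (p ⊑ q) × (q ⊑ p)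

  Incomparable : P → P → Set
  Incomparable p q = ¬ (p ⊑ q) × ¬ (q ⊑ p)

  Represents : Form → (P → Set) → Set
  Represents φ S =
    (∀ p q → S p → S q → p ≢ q → Incomparable p q) ×
    (∀ x → sem φ x ⇔ (∃ λ p → S p × up p x))

  FeaturesAnd : Set
  FeaturesAnd = ∀ φ ψ → Σ Form λ χ → ∀ x → sem χ x ⇔ (sem φ x × sem ψ x)

  -- ℒ finitely characterized by B (finite subsets of ℒ given as lists)
  FinitelyCharacterizedBy : (P → List Form) → Set
  FinitelyCharacterizedBy B = ∀ p →
    (B p ≢ []) ×
    All (λ ψ → sem ψ p) (B p) ×
    (∀ φ → sem φ p → ∀ x → All (λ ψ → sem ψ x) (B p) → sem φ x)

  Monotonic : (P → List Form) → Set
  Monotonic B = ∀ p q → p ⊑ q → ∀ ψ → ψ ∈ B p → ψ ∈ B q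

-- Classical metatheory (the paper works in ZFC): a choice function on
-- non-empty subsets of P, extensional in the subset.
record ChoiceOn (P : Set) : Set₁ where
  field
    ε      : (A : P → Set) → ∃ A → P
    ε-spec : ∀ (A : P → Set) (w : ∃ A) → A (ε A w)
    ε-ext  : ∀ (A B : P → Set) (w : ∃ A) (w' : ∃ B) → (∀ x → A x ⇔ B x) → ε A w ≡ ε B w'

{-# OPTIONS --safe #-}

-- Write z ⊏ y when ℒ(z) ⊊ ℒ(y). By monotonicity z ⊏ y gives B(z) ⊆ B(y), and by
-- characterization the inclusion is strict: some ψ ∈ B(y) is missing from B(z).
-- As B(y) is finite, ⊏ is well-founded, so every process satisfying φ lies above
-- a ⊏-minimal one. Choosing one canonical process per logical-equivalence class
-- of minimal processes yields a representing antichain. Conversely, if S and S'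
-- represent φ and p ∈ S, then p lies above some p' ∈ S', which lies above some
-- q ∈ S; the antichain condition forces q = p, so p and p' are equivalent.
module Submission where

open import Defs hiding (_⊑_)
open import Level using (0ℓ)
open import Data.Product using (∃; _×_; _,_; proj₁; proj₂)
open import Data.List using (List; length; filter)
open import Axiom.ExcludedMiddle using (ExcludedMiddle)
open import Data.Nat using (_<_)
open import Data.Nat.Induction using (<-wellFounded)
open import Data.List.Relation.Unary.All as All using (All)
import Data.List.Relation.Unary.Any as Any
open import Data.List.Membership.Propositional using (_∈_; _∉_)
open import Data.List.Membership.Propositional.Properties using (∈-filter⁺)
open import Data.List.Properties using (filter-notAll)
open import Function using (_on_; id)
open import Function.Bundles using (mk⇔; Equivalence)
open import Induction.WellFounded using (Acc; acc; WellFounded)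
import Relation.Binary.Construct.On as On
open import Relation.Nullary using (¬_; yes; no)
open import Relation.Nullary.Decidable using (decidable-stable)
open import Relation.Binary.PropositionalEquality using (_≡_; _≢_; refl; sym)

module Specialisation {P Form : Set} (sem : Form → P → Set) where

  infix 4 _⊑_ _⊏_

  _⊑_ : P → P → Set
  _⊑_ = Defs._⊑_ sem

  ⊑-refl : ∀ {p} → p ⊑ p
  ⊑-refl φ sp = sp

  ⊑-trans : ∀ {p q r} → p ⊑ q → q ⊑ r → p ⊑ r
  ⊑-trans p⊑q q⊑r φ sp = q⊑r φ (p⊑q φ sp)

  _⊏_ : P → P → Set
  z ⊏ y = z ⊑ y × ¬ (y ⊑ z)

module Uniqueness (em : ExcludedMiddle 0ℓ) {P Form : Set} (sem : Form → P → Set) where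

  open Specialisation sem

  member-sem : ∀ {φ S p} → Represents sem φ S → S p → sem φ p
  member-sem {p = p} (_ , cover) Sp = Equivalence.from (cover p) (p , Sp , ⊑-refl)

  member-below : ∀ {φ S x} → Represents sem φ S → sem φ x → ∃ λ p → S p × p ⊑ x
  member-below {x = x} (_ , cover) sx = Equivalence.to (cover x) sx

  antichain-⊑⇒≡ : ∀ {φ S p q} → Represents sem φ S → S p → S q → p ⊑ q → p ≡ q
  antichain-⊑⇒≡ {p = p} {q} (antichain , _) Sp Sq p⊑q =
    decidable-stable em λ p≢q → proj₁ (antichain p q Sp Sq p≢q) p⊑q

  represents-unique : ∀ φ (S S' : P → Set) → Represents sem φ S → Represents sem φ S' →
    ∀ p → S p → ∃ λ p' → S' p' × LogEquiv sem p p'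
  represents-unique φ S S' repS repS' p Sp
    with p' , S'p' , p'⊑p ← member-below repS' (member-sem repS Sp)
    with q , Sq , q⊑p' ← member-below repS (member-sem repS' S'p')
    with refl ← antichain-⊑⇒≡ repS Sq Sp (⊑-trans q⊑p' p'⊑p)
    = p' , S'p' , q⊑p' , p'⊑p

module Existence (em : ExcludedMiddle 0ℓ) {P Form : Set} (sem : Form → P → Set)
  (B : P → List Form) (fc : FinitelyCharacterizedBy sem B) (mono : Monotonic sem B) where

  open Specialisation sem

  remove : Form → List Form → List Form
  remove ψ = filter (λ χ → em {χ ≢ ψ})

  length-remove< : ∀ {ψ L} → ψ ∈ L → length (remove ψ L) < length L
  length-remove< {ψ} {L} ψ∈L =
    filter-notAll (λ χ → em {χ ≢ ψ}) L (Any.map (λ ψ≡χ χ≢ψ → χ≢ψ (sym ψ≡χ)) ψ∈L)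

  ∈-remove⁺ : ∀ {ψ χ L} → χ ∈ L → χ ≢ ψ → χ ∈ remove ψ L
  ∈-remove⁺ {ψ} = ∈-filter⁺ (λ χ → em {χ ≢ ψ})

  B-⊆⇒⊑ : ∀ {y z} → (∀ {ψ} → ψ ∈ B y → ψ ∈ B z) → y ⊑ z
  B-⊆⇒⊑ {y} {z} By⊆Bz φ sy =
    proj₂ (proj₂ (fc y)) φ sy z (All.tabulate λ ψ∈By → All.lookup (proj₁ (proj₂ (fc z))) (By⊆Bz ψ∈By))

  ⊏⇒B-lost : ∀ {y z} → z ⊏ y → ∃ λ ψ → ψ ∈ B y × ψ ∉ B z
  ⊏⇒B-lost (_ , y⋢z) = decidable-stable em λ nothing-lost →
    y⋢z (B-⊆⇒⊑ λ {ψ} ψ∈By → decidable-stable em λ ψ∉Bz → nothing-lost (ψ , ψ∈By , ψ∉Bz))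

  -- B(y) may repeat formulae, so the measure is the length of a list L bounding B(y), not of B(y).
  acc-bounded : ∀ {L y} → Acc (_<_ on length) L → (∀ {ψ} → ψ ∈ B y → ψ ∈ L) → Acc _⊏_ y
  acc-bounded (acc rs) By⊆L = acc λ {z} z⊏y →
    let ψ , ψ∈By , ψ∉Bz = ⊏⇒B-lost z⊏y in
    acc-bounded (rs (length-remove< (By⊆L ψ∈By)))
      λ χ∈Bz → ∈-remove⁺ (By⊆L (mono z _ (proj₁ z⊏y) _ χ∈Bz)) λ { refl → ψ∉Bz χ∈Bz }

  ⊏-wellFounded : WellFounded _⊏_
  ⊏-wellFounded y = acc-bounded (On.wellFounded length <-wellFounded (B y)) id

  Minimal : Form → P → Set
  Minimal φ m = sem φ m × (∀ {z} → sem φ z → ¬ (z ⊏ m))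

  minimal-⊑⇒⊒ : ∀ {φ m z} → Minimal φ m → sem φ z → z ⊑ m → m ⊑ z
  minimal-⊑⇒⊒ (_ , least) sz z⊑m = decidable-stable em λ m⋢z → least sz (z⊑m , m⋢z)

  minimal-below-acc : ∀ {φ y} → Acc _⊏_ y → sem φ y → ∃ λ m → Minimal φ m × m ⊑ y
  minimal-below-acc {φ} {y} (acc rs) sy with em {∃ λ z → sem φ z × z ⊏ y}
  ... | yes (z , sz , z⊏y) =
    let m , minimal , m⊑z = minimal-below-acc (rs z⊏y) sz in
    m , minimal , ⊑-trans m⊑z (proj₁ z⊏y)
  ... | no none = y , (sy , λ sz z⊏y → none (_ , sz , z⊏y)) , ⊑-refl

  minimal-below : ∀ {φ y} → sem φ y → ∃ λ m → Minimal φ m × m ⊑ y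
  minimal-below {y = y} = minimal-below-acc (⊏-wellFounded y)

  module WithChoice (ch : ChoiceOn P) where

    open ChoiceOn ch

    canonical : P → P
    canonical m = ε (LogEquiv sem m) (m , ⊑-refl , ⊑-refl)

    canonical-equiv : ∀ m → LogEquiv sem m (canonical m)
    canonical-equiv m = ε-spec (LogEquiv sem m) (m , ⊑-refl , ⊑-refl)

    canonical-cong : ∀ {m m'} → LogEquiv sem m m' → canonical m ≡ canonical m'
    canonical-cong (m⊑m' , m'⊑m) = ε-ext _ _ _ _ λ x →
      mk⇔ (λ (m⊑x , x⊑m) → ⊑-trans m'⊑m m⊑x , ⊑-trans x⊑m m⊑m')
          (λ (m'⊑x , x⊑m') → ⊑-trans m⊑m' m'⊑x , ⊑-trans x⊑m' m'⊑m)

    rep : Form → P → Set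
    rep φ x = ∃ λ m → Minimal φ m × x ≡ canonical m

    rep-⊑⇒≡ : ∀ {φ p q} → rep φ p → rep φ q → p ⊑ q → p ≡ q
    rep-⊑⇒≡ (m , (sm , _) , refl) (m' , minimal' , refl) p⊑q =
      canonical-cong (m⊑m' , minimal-⊑⇒⊒ minimal' sm m⊑m')
      where
      m⊑m' : m ⊑ m'
      m⊑m' = ⊑-trans (proj₁ (canonical-equiv m)) (⊑-trans p⊑q (proj₂ (canonical-equiv m')))

    rep-represents : ∀ φ → Represents sem φ (rep φ)
    rep-represents φ = antichain , λ x → mk⇔ above-rep (sem-above x)
      where
      antichain : ∀ p q → rep φ p → rep φ q → p ≢ q → Incomparable sem p q
      antichain p q rp rq p≢q =
        (λ p⊑q → p≢q (rep-⊑⇒≡ rp rq p⊑q)) , (λ q⊑p → p≢q (sym (rep-⊑⇒≡ rq rp q⊑p)))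

      above-rep : ∀ {x} → sem φ x → ∃ λ p → rep φ p × up sem p x
      above-rep sx with m , minimal , m⊑x ← minimal-below sx =
        canonical m , (m , minimal , refl) , ⊑-trans (proj₂ (canonical-equiv m)) m⊑x

      sem-above : ∀ x → (∃ λ p → rep φ p × up sem p x) → sem φ x
      sem-above x (_ , (m , (sm , _) , refl) , p⊑x) = p⊑x φ (proj₁ (canonical-equiv m) φ sm)

mainTheorem14 : ExcludedMiddle 0ℓ →
    (P Form : Set) → ChoiceOn P →
    (sem : Form → P → Set) →
    P →
    (∀ p → ∃ λ φ → sem φ p) →
    FeaturesAnd sem →
    (B : P → List Form) → FinitelyCharacterizedBy sem B → Monotonic sem B →
    (∀ φ → ∃ λ (S : P → Set) → Represents sem φ S) ×
    (∀ φ (S S' : P → Set) → Represents sem φ S → Represents sem φ S' →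
      ∀ p → S p → ∃ λ p' → S' p' × LogEquiv sem p p')
mainTheorem14 em P Form ch sem _ _ _ B fc mono =
  (λ φ → rep φ , rep-represents φ) , represents-unique em sem
  where
  open Existence.WithChoice em sem B fc mono ch using (rep; rep-represents)
  open Uniqueness using (represents-unique)
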